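{- Let $x,y$ be nonzero complex numbers. Then for every integer $n\geq 0$, $$\mathfrak{F}_{n+1}(x,y)+y\,\mathfrak{F}_{n}(x,y)=(x+y)\sum_{k=0}^{n}\binom{n}{k}\mathfrak{F}_{k}(x,y)\,\mathfrak{F}_{n-k}(x,y).$$
   Context: The generalized Fubini polynomials $\mathfrak{F}_n(x,y)$ are defined by $\sum_{n\geq0}\mathfrak{F}_n(x,y)\frac{t^n}{n!}=\frac{1}{1-\frac{x}{y}(e^{ty}-1)}$; equivalently $\mathfrak{F}_n(x,y)=\sum_{k=0}^n{n\brace k}k!x^ky^{n-k}$ with ${n\brace k}$ the Stirling numbers of the second kind. -}

module Defs where

open import Data.Nat as ℕ using (ℕ; zero; suc; _∸_)
open import Data.Nat.Combinatorics using (_C_)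
open import Data.Nat.Base using (_!)
open import Algebra.Bundles using (CommutativeRing)

stirling2 : ℕ → ℕ → ℕ
stirling2 zero    zero    = 1
stirling2 zero    (suc k) = 0
stirling2 (suc n) zero    = 0
stirling2 (suc n) (suc k) = suc k ℕ.* stirling2 n (suc k) ℕ.+ stirling2 n k

module FubiniDefs {c ℓ} (R : CommutativeRing c ℓ) where
  open CommutativeRing R

  ι : ℕ → Carrier
  ι zero    = 0#
  ι (suc n) = 1# + ι n

  pow : Carrier → ℕ → Carrier
  pow a zero    = 1#
  pow a (suc n) = a * pow a n

  sumTo : (ℕ → Carrier) → ℕ → Carrier
  sumTo f zero    = f 0
  sumTo f (suc n) = sumTo f n + f (suc n)

  F : ℕ → Carrier → Carrier → Carrier
  F n x y = sumTo (λ k → ι (stirling2 n k ℕ.* (k !)) * pow x k * pow y (n ∸ k)) n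

{-# OPTIONS --safe #-}
-- Write a(n,i) = S(n,i) i!, the number of surjections from an n-set onto an
-- i-set, so that F_n = Σ_i a(n,i) x^i y^(n-i). Splitting a surjection onto
-- i + l points according to the preimage of the first i points gives the
-- binomial convolution Σ_k C(n,k) a(k,i) a(n-k,l) = a(n,i+l); hence the
-- binomial self-convolution of (F_n) is Σ_m (m+1) a(n,m) x^m y^(n-m).
-- The recurrence a(n+1,m) = m (a(n,m) + a(n,m-1)) expresses F_(n+1) through
-- the same weighted sums, and comparing the two gives the identity (which is
-- the e.g.f. equation G' = (x+y) G² - y G coefficientwise).
module Submission where

open import Defs
open import Algebra.Bundles using (CommutativeRing)
open import Data.Nat as ℕ using (ℕ; zero; suc; pred; _∸_; _≤_; _<_; z≤n; s≤s; _≤?_)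
open import Data.Nat.Base using (_!)
open import Data.Nat.Combinatorics using (_C_; k>n⇒nCk≡0; nCk+nC[k+1]≡[n+1]C[k+1])
import Data.Nat.Properties as ℕₚ
open import Data.Nat.Properties
  using (+-suc; +-∸-assoc; m+n∸n≡m; m∸n+n≡m; m+[n∸m]≡n; m∸n≤m;
         m<n⇒m<1+n; m≤n⇒m≤1+n; m≤n⇒m<n∨m≡n; ≤-refl; n<1+n; m≤n+m; ≰⇒>)
open import Data.Nat.Tactic.RingSolver using (solve-∀)
open import Data.Sum using (inj₁; inj₂)
open import Function using (_∘_)
open import Relation.Nullary using (¬_; yes; no)
open import Relation.Binary.PropositionalEquality as ≡ using (_≡_)

n<k⇒stirling2≡0 : ∀ {n k} → n < k → stirling2 n k ≡ 0
n<k⇒stirling2≡0 {zero}  {suc k} _ = ≡.refl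
n<k⇒stirling2≡0 {suc n} {suc k} (s≤s n<k)
  rewrite n<k⇒stirling2≡0 (m<n⇒m<1+n n<k) | n<k⇒stirling2≡0 n<k
  = ≡.trans (ℕₚ.+-identityʳ _) (ℕₚ.*-zeroʳ (suc k))

surjections : ℕ → ℕ → ℕ
surjections n k = stirling2 n k ℕ.* k !

n<k⇒surjections≡0 : ∀ {n k} → n < k → surjections n k ≡ 0
n<k⇒surjections≡0 {k = k} n<k = ≡.cong (ℕ._* k !) (n<k⇒stirling2≡0 n<k)

surjections-suc : ∀ n k →
  surjections (suc n) (suc k) ≡ suc k ℕ.* (surjections n (suc k) ℕ.+ surjections n k)
surjections-suc n k = normalise (suc k) (stirling2 n (suc k)) (stirling2 n k) (k !)
  where
  normalise : ∀ s a b f → (s ℕ.* a ℕ.+ b) ℕ.* (s ℕ.* f) ≡ s ℕ.* (a ℕ.* (s ℕ.* f) ℕ.+ b ℕ.* f)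
  normalise = solve-∀

[k∸i]+[[n∸k]∸l]≡n∸[i+l] : ∀ {i k l n} → i ≤ k → l ≤ n ∸ k → k ≤ n →
  (k ∸ i) ℕ.+ ((n ∸ k) ∸ l) ≡ n ∸ (i ℕ.+ l)
[k∸i]+[[n∸k]∸l]≡n∸[i+l] {i} {k} {l} {n} i≤k l≤n∸k k≤n = begin
  p ℕ.+ q                                ≡⟨ m+n∸n≡m (p ℕ.+ q) (i ℕ.+ l) ⟨
  (p ℕ.+ q) ℕ.+ (i ℕ.+ l) ∸ (i ℕ.+ l)    ≡⟨ ≡.cong (_∸ (i ℕ.+ l)) sum≡n ⟩
  n ∸ (i ℕ.+ l)                          ∎
  where
  open ≡.≡-Reasoning
  p = k ∸ i
  q = (n ∸ k) ∸ l
  interchange : ∀ a b c d → (a ℕ.+ b) ℕ.+ (c ℕ.+ d) ≡ (a ℕ.+ c) ℕ.+ (b ℕ.+ d)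
  interchange = solve-∀
  sum≡n : (p ℕ.+ q) ℕ.+ (i ℕ.+ l) ≡ n
  sum≡n = ≡.trans (interchange p q i l)
            (≡.trans (≡.cong₂ ℕ._+_ (m∸n+n≡m i≤k) (m∸n+n≡m l≤n∸k)) (m+[n∸m]≡n k≤n))

module FubiniIdentity {c ℓ} (R : CommutativeRing c ℓ) where
  open CommutativeRing R
  open FubiniDefs R
  open import Algebra.Properties.Semiring.Mult semiring using (_×_; ×-homo-+; ×1-homo-*)
  open import Algebra.Properties.Semiring.Exp semiring using (_^_; ^-homo-*)
  open import Algebra.Properties.CommutativeSemigroup +-commutativeSemigroup
    using (interchange; x∙yz≈y∙xz)
  open import Algebra.Properties.CommutativeSemigroup *-commutativeSemigroup
    using () renaming (interchange to *-interchange; x∙yz≈y∙xz to x*yz≈y*xz)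
  open import Algebra.Solver.Ring.NaturalCoefficients.Default commutativeSemiring
    using (solve; _:+_; _:*_; _:=_)
  open import Relation.Binary.Reasoning.Setoid setoid

  ι≈×1# : ∀ n → ι n ≈ n × 1#
  ι≈×1# zero    = refl
  ι≈×1# (suc n) = +-congˡ (ι≈×1# n)

  ι-homo-+ : ∀ m n → ι (m ℕ.+ n) ≈ ι m + ι n
  ι-homo-+ m n = begin
    ι (m ℕ.+ n)      ≈⟨ ι≈×1# (m ℕ.+ n) ⟩
    (m ℕ.+ n) × 1#   ≈⟨ ×-homo-+ 1# m n ⟩
    m × 1# + n × 1#  ≈⟨ +-cong (ι≈×1# m) (ι≈×1# n) ⟨
    ι m + ι n        ∎

  ι-homo-* : ∀ m n → ι (m ℕ.* n) ≈ ι m * ι n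
  ι-homo-* m n = begin
    ι (m ℕ.* n)          ≈⟨ ι≈×1# (m ℕ.* n) ⟩
    (m ℕ.* n) × 1#       ≈⟨ ×1-homo-* m n ⟩
    (m × 1#) * (n × 1#)  ≈⟨ *-cong (ι≈×1# m) (ι≈×1# n) ⟨
    ι m * ι n            ∎

  ι-suc-* : ∀ m a → ι (suc m) * a ≈ a + ι m * a
  ι-suc-* m a = trans (distribʳ a 1# (ι m)) (+-congʳ (*-identityˡ a))

  pow≈^ : ∀ a n → pow a n ≈ a ^ n
  pow≈^ a zero    = refl
  pow≈^ a (suc n) = *-congˡ (pow≈^ a n)

  pow-homo-* : ∀ a m n → pow a (m ℕ.+ n) ≈ pow a m * pow a n
  pow-homo-* a m n = begin
    pow a (m ℕ.+ n)      ≈⟨ pow≈^ a (m ℕ.+ n) ⟩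
    a ^ (m ℕ.+ n)        ≈⟨ ^-homo-* a m n ⟩
    a ^ m * a ^ n        ≈⟨ *-cong (pow≈^ a m) (pow≈^ a n) ⟨
    pow a m * pow a n    ∎

  sumTo-cong : ∀ {f g} n → (∀ k → k ≤ n → f k ≈ g k) → sumTo f n ≈ sumTo g n
  sumTo-cong zero    f≈g = f≈g 0 z≤n
  sumTo-cong (suc n) f≈g =
    +-cong (sumTo-cong n λ k k≤n → f≈g k (m≤n⇒m≤1+n k≤n)) (f≈g (suc n) ≤-refl)

  sumTo-distrib-+ : ∀ f g n → sumTo (λ k → f k + g k) n ≈ sumTo f n + sumTo g n
  sumTo-distrib-+ f g zero    = refl
  sumTo-distrib-+ f g (suc n) =
    trans (+-congʳ (sumTo-distrib-+ f g n)) (interchange _ _ _ _)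

  *-distribˡ-sumTo : ∀ a f n → a * sumTo f n ≈ sumTo (λ k → a * f k) n
  *-distribˡ-sumTo a f zero    = refl
  *-distribˡ-sumTo a f (suc n) =
    trans (distribˡ a (sumTo f n) (f (suc n))) (+-congʳ (*-distribˡ-sumTo a f n))

  *-distribʳ-sumTo : ∀ a f n → sumTo f n * a ≈ sumTo (λ k → f k * a) n
  *-distribʳ-sumTo a f n =
    trans (*-comm _ a) (trans (*-distribˡ-sumTo a f n) (sumTo-cong n λ k _ → *-comm a (f k)))

  sumTo-sucˡ : ∀ f n → sumTo f (suc n) ≈ f 0 + sumTo (f ∘ suc) n
  sumTo-sucˡ f zero    = refl
  sumTo-sucˡ f (suc n) = trans (+-congʳ (sumTo-sucˡ f n)) (+-assoc _ _ _)

  sumTo-dropLast : ∀ f n → f (suc n) ≈ 0# → sumTo f (suc n) ≈ sumTo f n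
  sumTo-dropLast f n last≈0 = trans (+-congˡ last≈0) (+-identityʳ _)

  sumTo-extend : ∀ f m n → m ≤ n → (∀ k → m < k → k ≤ n → f k ≈ 0#) → sumTo f n ≈ sumTo f m
  sumTo-extend f m zero    z≤n _    = refl
  sumTo-extend f m (suc n) m≤1+n f≈0 with m≤n⇒m<n∨m≡n m≤1+n
  ... | inj₂ ≡.refl      = refl
  ... | inj₁ (s≤s m≤n) = trans (sumTo-dropLast f n (f≈0 (suc n) (s≤s m≤n) ≤-refl))
                                (sumTo-extend f m n m≤n λ k m<k k≤n → f≈0 k m<k (m≤n⇒m≤1+n k≤n))

  sumTo-comm : ∀ (f : ℕ → ℕ → Carrier) m n →
    sumTo (λ i → sumTo (f i) n) m ≈ sumTo (λ j → sumTo (λ i → f i j) m) n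
  sumTo-comm f zero    n = refl
  sumTo-comm f (suc m) n = trans (+-congʳ (sumTo-comm f m n))
    (sym (sumTo-distrib-+ (λ j → sumTo (λ i → f i j) m) (f (suc m)) n))

  sumTo-*-sumTo : ∀ f g m n → sumTo f m * sumTo g n ≈ sumTo (λ i → sumTo (λ j → f i * g j) n) m
  sumTo-*-sumTo f g m n = trans (*-distribʳ-sumTo (sumTo g n) f m)
                                (sumTo-cong m λ i _ → *-distribˡ-sumTo (f i) g n)

  sumTo-antidiagonal : ∀ n (f : ℕ → Carrier) → (∀ m → n < m → f m ≈ 0#) →
    sumTo (λ i → sumTo (λ l → f (i ℕ.+ l)) n) n ≈ sumTo (λ m → ι (suc m) * f m) n
  sumTo-antidiagonal zero    f _   = sym (trans (*-congʳ (+-identityʳ 1#)) (*-identityˡ _))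
  sumTo-antidiagonal (suc n) f f≈0 = begin
    sumTo (λ i → sumTo (λ l → f (i ℕ.+ l)) (suc n)) (suc n)
      ≈⟨ sumTo-sucˡ (λ i → sumTo (λ l → f (i ℕ.+ l)) (suc n)) n ⟩
    sumTo f (suc n) + sumTo (λ i → sumTo (λ l → f (suc i ℕ.+ l)) (suc n)) n
      ≈⟨ +-cong (sumTo-sucˡ f n) (sumTo-cong n λ i _ → sumTo-dropLast (λ l → f (suc i ℕ.+ l)) n (beyond i)) ⟩
    (f 0 + sumTo (f ∘ suc) n) + sumTo (λ i → sumTo (λ l → f (suc i ℕ.+ l)) n) n
      ≈⟨ +-congˡ (sumTo-antidiagonal n (f ∘ suc) λ m n<m → f≈0 (suc m) (s≤s n<m)) ⟩
    (f 0 + sumTo (f ∘ suc) n) + sumTo (λ m → ι (suc m) * f (suc m)) n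
      ≈⟨ trans (+-assoc _ _ _) (+-congˡ (sym (sumTo-distrib-+ (f ∘ suc) (λ m → ι (suc m) * f (suc m)) n))) ⟩
    f 0 + sumTo (λ m → f (suc m) + ι (suc m) * f (suc m)) n
      ≈⟨ +-cong (sym (*-identityˡ _)) (sumTo-cong n λ m _ → sym (ι-suc-* (suc m) (f (suc m)))) ⟩
    1# * f 0 + sumTo (λ m → ι (suc (suc m)) * f (suc m)) n
      ≈⟨ +-congʳ (*-congʳ (sym (+-identityʳ 1#))) ⟩
    ι 1 * f 0 + sumTo (λ m → ι (suc (suc m)) * f (suc m)) n
      ≈⟨ sumTo-sucˡ (λ m → ι (suc m) * f m) n ⟨
    sumTo (λ m → ι (suc m) * f m) (suc n) ∎
    where
    beyond : ∀ i → f (suc i ℕ.+ suc n) ≈ 0#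
    beyond i = f≈0 (suc i ℕ.+ suc n) (s≤s (m≤n+m (suc n) i))

  -- The coefficient of t^n/n! in the product of the e.g.f.s of f and g.
  infixl 7 _⊛_
  _⊛_ : (ℕ → Carrier) → (ℕ → Carrier) → ℕ → Carrier
  (f ⊛ g) n = sumTo (λ k → ι (n C k) * (f k * g (n ∸ k))) n

  ⊛-cong : ∀ {f f′ g g′} n → (∀ k → k ≤ n → f k ≈ f′ k) → (∀ k → k ≤ n → g k ≈ g′ k) →
    (f ⊛ g) n ≈ (f′ ⊛ g′) n
  ⊛-cong n f≈f′ g≈g′ =
    sumTo-cong n λ k k≤n → *-congˡ (*-cong (f≈f′ k k≤n) (g≈g′ (n ∸ k) (m∸n≤m n k)))

  ⊛-linearˡ : ∀ a f₁ f₂ g n →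
    ((λ k → a * (f₁ k + f₂ k)) ⊛ g) n ≈ a * ((f₁ ⊛ g) n + (f₂ ⊛ g) n)
  ⊛-linearˡ a f₁ f₂ g n = sym (begin
    a * ((f₁ ⊛ g) n + (f₂ ⊛ g) n)      ≈⟨ *-congˡ (sym (sumTo-distrib-+ t₁ t₂ n)) ⟩
    a * sumTo (λ k → t₁ k + t₂ k) n    ≈⟨ *-distribˡ-sumTo a _ n ⟩
    sumTo (λ k → a * (t₁ k + t₂ k)) n
      ≈⟨ sumTo-cong n (λ k _ → normalise a (ι (n C k)) (f₁ k) (f₂ k) (g (n ∸ k))) ⟩
    ((λ k → a * (f₁ k + f₂ k)) ⊛ g) n  ∎)
    where
    t₁ t₂ : ℕ → Carrier
    t₁ k = ι (n C k) * (f₁ k * g (n ∸ k))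
    t₂ k = ι (n C k) * (f₂ k * g (n ∸ k))
    normalise : ∀ a b p q z → a * (b * (p * z) + b * (q * z)) ≈ b * ((a * (p + q)) * z)
    normalise = solve 5 (λ a b p q z → a :* (b :* (p :* z) :+ b :* (q :* z))
                                    := b :* ((a :* (p :+ q)) :* z)) refl

  ⊛-linearʳ : ∀ a f g₁ g₂ n →
    (f ⊛ (λ k → a * (g₁ k + g₂ k))) n ≈ a * ((f ⊛ g₁) n + (f ⊛ g₂) n)
  ⊛-linearʳ a f g₁ g₂ n = sym (begin
    a * ((f ⊛ g₁) n + (f ⊛ g₂) n)      ≈⟨ *-congˡ (sym (sumTo-distrib-+ t₁ t₂ n)) ⟩
    a * sumTo (λ k → t₁ k + t₂ k) n    ≈⟨ *-distribˡ-sumTo a _ n ⟩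
    sumTo (λ k → a * (t₁ k + t₂ k)) n
      ≈⟨ sumTo-cong n (λ k _ → normalise a (ι (n C k)) (g₁ (n ∸ k)) (g₂ (n ∸ k)) (f k)) ⟩
    (f ⊛ (λ k → a * (g₁ k + g₂ k))) n  ∎)
    where
    t₁ t₂ : ℕ → Carrier
    t₁ k = ι (n C k) * (f k * g₁ (n ∸ k))
    t₂ k = ι (n C k) * (f k * g₂ (n ∸ k))
    normalise : ∀ a b p q z → a * (b * (z * p) + b * (z * q)) ≈ b * (z * (a * (p + q)))
    normalise = solve 5 (λ a b p q z → a :* (b :* (z :* p) :+ b :* (z :* q))
                                    := b :* (z :* (a :* (p :+ q)))) refl

  -- Leibniz rule (fg)' = f'g + fg' for e.g.f.s, from Pascal's rule.
  ⊛-suc : ∀ f g n → (f ⊛ g) (suc n) ≈ ((f ∘ suc) ⊛ g) n + (f ⊛ (g ∘ suc)) n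
  ⊛-suc f g n = begin
    (f ⊛ g) (suc n)
      ≈⟨ sumTo-sucˡ _ n ⟩
    head + sumTo (λ k → ι (suc n C suc k) * (f (suc k) * g (n ∸ k))) n
      ≈⟨ +-congˡ (sumTo-cong n λ k _ → pascal k) ⟩
    head + sumTo (λ k → T k + U k) n
      ≈⟨ +-congˡ (sumTo-distrib-+ T U n) ⟩
    head + (sumTo T n + sumTo U n)
      ≈⟨ x∙yz≈y∙xz head (sumTo T n) (sumTo U n) ⟩
    sumTo T n + (head + sumTo U n)
      ≈⟨ +-congˡ (sumTo-sucˡ shifted n) ⟨
    sumTo T n + sumTo shifted (suc n)
      ≈⟨ +-congˡ (sumTo-dropLast shifted n (trans (*-congʳ nC[1+n]≈0) (zeroˡ _))) ⟩
    sumTo T n + sumTo shifted n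
      ≈⟨ +-congˡ (sumTo-cong n λ k k≤n → reflexive (≡.cong (λ m → ι (n C k) * (f k * g m)) (+-∸-assoc 1 k≤n))) ⟩
    ((f ∘ suc) ⊛ g) n + (f ⊛ (g ∘ suc)) n ∎
    where
    head = ι (suc n C 0) * (f 0 * g (suc n))
    T U shifted : ℕ → Carrier
    T k = ι (n C k) * (f (suc k) * g (n ∸ k))
    U k = ι (n C suc k) * (f (suc k) * g (n ∸ k))
    shifted k = ι (n C k) * (f k * g (suc n ∸ k))
    nC[1+n]≈0 : ι (n C suc n) ≈ 0#
    nC[1+n]≈0 = reflexive (≡.cong ι (k>n⇒nCk≡0 (n<1+n n)))
    pascal : ∀ k → ι (suc n C suc k) * (f (suc k) * g (n ∸ k)) ≈ T k + U k
    pascal k = trans (*-congʳ (trans (reflexive (≡.cong ι (≡.sym (nCk+nC[k+1]≡[n+1]C[k+1] n k))))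
                                     (ι-homo-+ (n C k) (n C suc k))))
                     (distribʳ _ _ _)

  ⊛-zero : ∀ f g → (f ⊛ g) 0 ≈ f 0 * g 0
  ⊛-zero f g = trans (*-congʳ (+-identityʳ 1#)) (*-identityˡ _)

  sumTo-⊛-sumTo : ∀ (f g : ℕ → ℕ → Carrier) N n →
    ((λ k → sumTo (f k) N) ⊛ (λ k → sumTo (g k) N)) n
      ≈ sumTo (λ i → sumTo (λ j → ((λ k → f k i) ⊛ (λ k → g k j)) n) N) N
  sumTo-⊛-sumTo f g N n = begin
    sumTo (λ k → ι (n C k) * (sumTo (f k) N * sumTo (g (n ∸ k)) N)) n
      ≈⟨ sumTo-cong n (λ k _ → *-congˡ (sumTo-*-sumTo (f k) (g (n ∸ k)) N N)) ⟩
    sumTo (λ k → ι (n C k) * sumTo (λ i → sumTo (λ j → f k i * g (n ∸ k) j) N) N) n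
      ≈⟨ sumTo-cong n (λ k _ → trans (*-distribˡ-sumTo _ _ N) (sumTo-cong N λ i _ → *-distribˡ-sumTo _ _ N)) ⟩
    sumTo (λ k → sumTo (λ i → sumTo (λ j → term k i j) N) N) n
      ≈⟨ sumTo-comm (λ k i → sumTo (term k i) N) n N ⟩
    sumTo (λ i → sumTo (λ k → sumTo (term k i) N) n) N
      ≈⟨ sumTo-cong N (λ i _ → sumTo-comm (λ k → term k i) n N) ⟩
    sumTo (λ i → sumTo (λ j → sumTo (λ k → term k i j) n) N) N ∎
    where
    term : ℕ → ℕ → ℕ → Carrier
    term k i j = ι (n C k) * (f k i * g (n ∸ k) j)

  surj : ℕ → ℕ → Carrier
  surj n k = ι (surjections n k)

  n<k⇒surj≈0 : ∀ {n k} → n < k → surj n k ≈ 0#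
  n<k⇒surj≈0 n<k = reflexive (≡.cong ι (n<k⇒surjections≡0 n<k))

  -- At k = 0 the junk value pred 0 = 0 is harmless: the factor ι 0 is 0#.
  surj-suc : ∀ n k → surj (suc n) k ≈ ι k * (surj n k + surj n (pred k))
  surj-suc n zero    = sym (zeroˡ _)
  surj-suc n (suc k) = begin
    ι (surjections (suc n) (suc k))
      ≈⟨ reflexive (≡.cong ι (surjections-suc n k)) ⟩
    ι (suc k ℕ.* (surjections n (suc k) ℕ.+ surjections n k))
      ≈⟨ ι-homo-* (suc k) (surjections n (suc k) ℕ.+ surjections n k) ⟩
    ι (suc k) * ι (surjections n (suc k) ℕ.+ surjections n k)
      ≈⟨ *-congˡ (ι-homo-+ (surjections n (suc k)) (surjections n k)) ⟩
    ι (suc k) * (surj n (suc k) + surj n k) ∎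

  surj-*-congˡ : ∀ {n i u v} → (i ≤ n → u ≈ v) → surj n i * u ≈ surj n i * v
  surj-*-congˡ {n} {i} u≈v with i ≤? n
  ... | yes i≤n = *-congˡ (u≈v i≤n)
  ... | no  i≰n = trans (*-congʳ surj≈0) (trans (zeroˡ _) (sym (trans (*-congʳ surj≈0) (zeroˡ _))))
    where surj≈0 = n<k⇒surj≈0 (≰⇒> i≰n)

  surj-convolution : ∀ n i l → ((λ k → surj k i) ⊛ (λ k → surj k l)) n ≈ surj n (i ℕ.+ l)
  surj-convolution zero i l = trans (⊛-zero (λ k → surj k i) (λ k → surj k l)) (base i l)
    where
    base : ∀ i l → surj 0 i * surj 0 l ≈ surj 0 (i ℕ.+ l)
    base zero    zero    = trans (*-congʳ (+-identityʳ 1#)) (*-identityˡ _)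
    base zero    (suc l) = zeroʳ _
    base (suc i) l       = zeroˡ _
  surj-convolution (suc n) i l = begin
    (f ⊛ g) (suc n)
      ≈⟨ ⊛-suc f g n ⟩
    ((f ∘ suc) ⊛ g) n + (f ⊛ (g ∘ suc)) n
      ≈⟨ +-cong (⊛-cong {g = g} n (λ k _ → surj-suc k i) (λ _ _ → refl))
                (⊛-cong {f = f} n (λ _ _ → refl) (λ k _ → surj-suc k l)) ⟩
    ((λ k → ι i * (f k + f′ k)) ⊛ g) n + (f ⊛ (λ k → ι l * (g k + g′ k))) n
      ≈⟨ +-cong (⊛-linearˡ (ι i) f f′ g n) (⊛-linearʳ (ι l) f g g′ n) ⟩
    ι i * ((f ⊛ g) n + (f′ ⊛ g) n) + ι l * ((f ⊛ g) n + (f ⊛ g′) n)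
      ≈⟨ +-cong (*-congˡ (+-cong (surj-convolution n i l) (surj-convolution n (pred i) l)))
                (*-congˡ (+-cong (surj-convolution n i l) (surj-convolution n i (pred l)))) ⟩
    ι i * (surj n (i ℕ.+ l) + surj n (pred i ℕ.+ l)) + ι l * (surj n (i ℕ.+ l) + surj n (i ℕ.+ pred l))
      ≈⟨ +-cong (pred-left i) (pred-right l) ⟩
    ι i * Z + ι l * Z
      ≈⟨ trans (*-congʳ (ι-homo-+ i l)) (distribʳ Z (ι i) (ι l)) ⟨
    ι (i ℕ.+ l) * Z
      ≈⟨ surj-suc n (i ℕ.+ l) ⟨
    surj (suc n) (i ℕ.+ l) ∎
    where
    f f′ g g′ : ℕ → Carrier
    f  k = surj k i
    f′ k = surj k (pred i)
    g  k = surj k l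
    g′ k = surj k (pred l)
    Z = surj n (i ℕ.+ l) + surj n (pred (i ℕ.+ l))
    pred-left : ∀ i → ι i * (surj n (i ℕ.+ l) + surj n (pred i ℕ.+ l))
                    ≈ ι i * (surj n (i ℕ.+ l) + surj n (pred (i ℕ.+ l)))
    pred-left zero    = trans (zeroˡ _) (sym (zeroˡ _))
    pred-left (suc i) = refl
    pred-right : ∀ l → ι l * (surj n (i ℕ.+ l) + surj n (i ℕ.+ pred l))
                     ≈ ι l * (surj n (i ℕ.+ l) + surj n (pred (i ℕ.+ l)))
    pred-right zero    = trans (zeroˡ _) (sym (zeroˡ _))
    pred-right (suc l) = *-congˡ (+-congˡ (reflexive (≡.cong (surj n ∘ pred) (≡.sym (+-suc i l)))))

  module Polynomials (x y : Carrier) where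

    monomial : ℕ → ℕ → Carrier
    monomial i n = pow x i * pow y (n ∸ i)

    term : ℕ → ℕ → Carrier
    term n i = surj n i * pow x i * pow y (n ∸ i)

    term≈surj*monomial : ∀ n i → term n i ≈ surj n i * monomial i n
    term≈surj*monomial n i = *-assoc _ _ _

    n<i⇒term≈0 : ∀ {n i} → n < i → term n i ≈ 0#
    n<i⇒term≈0 n<i = trans (*-congʳ (*-congʳ (n<k⇒surj≈0 n<i))) (trans (*-congʳ (zeroˡ _)) (zeroˡ _))

    monomial-suc : ∀ i n → monomial (suc i) (suc n) ≈ x * monomial i n
    monomial-suc i n = *-assoc _ _ _

    monomial-sucʳ : ∀ {i n} → i ≤ n → monomial i (suc n) ≈ y * monomial i n
    monomial-sucʳ {i} {n} i≤n =
      trans (*-congˡ (reflexive (≡.cong (pow y) (+-∸-assoc 1 i≤n)))) (x*yz≈y*xz _ _ _)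

    monomial-* : ∀ {i k l n} → i ≤ k → l ≤ n ∸ k → k ≤ n →
      monomial i k * monomial l (n ∸ k) ≈ monomial (i ℕ.+ l) n
    monomial-* {i} {k} {l} {n} i≤k l≤n∸k k≤n = begin
      (pow x i * pow y (k ∸ i)) * (pow x l * pow y ((n ∸ k) ∸ l))
        ≈⟨ *-interchange _ _ _ _ ⟩
      (pow x i * pow x l) * (pow y (k ∸ i) * pow y ((n ∸ k) ∸ l))
        ≈⟨ *-cong (pow-homo-* x i l) (pow-homo-* y (k ∸ i) _) ⟨
      pow x (i ℕ.+ l) * pow y ((k ∸ i) ℕ.+ ((n ∸ k) ∸ l))
        ≈⟨ *-congˡ (reflexive (≡.cong (pow y) ([k∸i]+[[n∸k]∸l]≡n∸[i+l] i≤k l≤n∸k k≤n))) ⟩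
      monomial (i ℕ.+ l) n ∎

    term-suc : ∀ n j → term (suc n) (suc j) ≈ ι (suc j) * (y * term n (suc j) + x * term n j)
    term-suc n j = begin
      term (suc n) (suc j)
        ≈⟨ term≈surj*monomial (suc n) (suc j) ⟩
      surj (suc n) (suc j) * m
        ≈⟨ *-congʳ (surj-suc n (suc j)) ⟩
      ι (suc j) * (surj n (suc j) + surj n j) * m
        ≈⟨ trans (*-assoc _ _ _) (*-congˡ (distribʳ m _ _)) ⟩
      ι (suc j) * (surj n (suc j) * m + surj n j * m)
        ≈⟨ *-congˡ (+-cong (surj-*-congˡ (monomial-sucʳ {suc j} {n})) (*-congˡ (monomial-suc j n))) ⟩
      ι (suc j) * (surj n (suc j) * (y * monomial (suc j) n) + surj n j * (x * monomial j n))
        ≈⟨ *-congˡ (+-cong (x*yz≈y*xz _ _ _) (x*yz≈y*xz _ _ _)) ⟩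
      ι (suc j) * (y * (surj n (suc j) * monomial (suc j) n) + x * (surj n j * monomial j n))
        ≈⟨ *-congˡ (+-cong (*-congˡ (term≈surj*monomial n (suc j))) (*-congˡ (term≈surj*monomial n j))) ⟨
      ι (suc j) * (y * term n (suc j) + x * term n j) ∎
      where
      m = monomial (suc j) (suc n)

    term-convolution : ∀ n i l → ((λ k → term k i) ⊛ (λ k → term k l)) n ≈ term n (i ℕ.+ l)
    term-convolution n i l = begin
      ((λ k → term k i) ⊛ (λ k → term k l)) n
        ≈⟨ sumTo-cong n (λ k k≤n → pointwise k k≤n) ⟩
      sumTo (λ k → ι (n C k) * (surj k i * surj (n ∸ k) l) * monomial (i ℕ.+ l) n) n
        ≈⟨ *-distribʳ-sumTo _ _ n ⟨
      ((λ k → surj k i) ⊛ (λ k → surj k l)) n * monomial (i ℕ.+ l) n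
        ≈⟨ *-congʳ (surj-convolution n i l) ⟩
      surj n (i ℕ.+ l) * monomial (i ℕ.+ l) n
        ≈⟨ term≈surj*monomial n (i ℕ.+ l) ⟨
      term n (i ℕ.+ l) ∎
      where
      pointwise : ∀ k → k ≤ n → ι (n C k) * (term k i * term (n ∸ k) l)
                                 ≈ ι (n C k) * (surj k i * surj (n ∸ k) l) * monomial (i ℕ.+ l) n
      pointwise k k≤n = begin
        ι (n C k) * (term k i * term (n ∸ k) l)
          ≈⟨ regroup _ _ _ _ _ _ _ ⟩
        ι (n C k) * (surj k i * (surj (n ∸ k) l * (monomial i k * monomial l (n ∸ k))))
          ≈⟨ *-congˡ (surj-*-congˡ λ i≤k → surj-*-congˡ λ l≤n∸k → monomial-* i≤k l≤n∸k k≤n) ⟩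
        ι (n C k) * (surj k i * (surj (n ∸ k) l * monomial (i ℕ.+ l) n))
          ≈⟨ regroup′ _ _ _ _ ⟩
        ι (n C k) * (surj k i * surj (n ∸ k) l) * monomial (i ℕ.+ l) n ∎
        where
        regroup : ∀ c s t a b d e → c * ((s * a * b) * (t * d * e)) ≈ c * (s * (t * ((a * b) * (d * e))))
        regroup = solve 7 (λ c s t a b d e → c :* ((s :* a :* b) :* (t :* d :* e))
                                          := c :* (s :* (t :* ((a :* b) :* (d :* e))))) refl
        regroup′ : ∀ c s t m → c * (s * (t * m)) ≈ c * (s * t) * m
        regroup′ = solve 4 (λ c s t m → c :* (s :* (t :* m)) := c :* (s :* t) :* m) refl

    Fubini : ℕ → Carrier
    Fubini n = F n x y

    Fubini-extend : ∀ {k n} → k ≤ n → Fubini k ≈ sumTo (term k) n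
    Fubini-extend {k} {n} k≤n = sym (sumTo-extend (term k) k n k≤n λ i k<i _ → n<i⇒term≈0 k<i)

    weighted : (ℕ → Carrier) → ℕ → Carrier
    weighted w n = sumTo (λ m → w m * term n m) n

    Fubini-convolution : ∀ n → (Fubini ⊛ Fubini) n ≈ weighted (ι ∘ suc) n
    Fubini-convolution n = begin
      (Fubini ⊛ Fubini) n
        ≈⟨ ⊛-cong n (λ k → Fubini-extend) (λ k → Fubini-extend) ⟩
      ((λ k → sumTo (term k) n) ⊛ (λ k → sumTo (term k) n)) n
        ≈⟨ sumTo-⊛-sumTo term term n n ⟩
      sumTo (λ i → sumTo (λ l → ((λ k → term k i) ⊛ (λ k → term k l)) n) n) n
        ≈⟨ sumTo-cong n (λ i _ → sumTo-cong n λ l _ → term-convolution n i l) ⟩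
      sumTo (λ i → sumTo (λ l → term n (i ℕ.+ l)) n) n
        ≈⟨ sumTo-antidiagonal n (term n) (λ m n<m → n<i⇒term≈0 n<m) ⟩
      weighted (ι ∘ suc) n ∎

    Fubini-suc : ∀ n → Fubini (suc n) ≈ y * weighted ι n + x * weighted (ι ∘ suc) n
    Fubini-suc n = begin
      sumTo (term (suc n)) (suc n)
        ≈⟨ sumTo-sucˡ (term (suc n)) n ⟩
      term (suc n) 0 + sumTo (term (suc n) ∘ suc) n
        ≈⟨ +-cong (trans (*-congʳ (zeroˡ _)) (zeroˡ _))
                  (sumTo-cong n λ j _ → term-suc n j) ⟩
      0# + sumTo (λ j → ι (suc j) * (y * term n (suc j) + x * term n j)) n
        ≈⟨ +-identityˡ _ ⟩
      sumTo (λ j → ι (suc j) * (y * term n (suc j) + x * term n j)) n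
        ≈⟨ sumTo-cong n (λ j _ → split _ _ _ _ _) ⟩
      sumTo (λ j → y * (ι (suc j) * term n (suc j)) + x * (ι (suc j) * term n j)) n
        ≈⟨ sumTo-distrib-+ _ _ n ⟩
      sumTo (λ j → y * (ι (suc j) * term n (suc j))) n + sumTo (λ j → x * (ι (suc j) * term n j)) n
        ≈⟨ +-cong (*-distribˡ-sumTo y _ n) (*-distribˡ-sumTo x _ n) ⟨
      y * sumTo (λ j → ι (suc j) * term n (suc j)) n + x * weighted (ι ∘ suc) n
        ≈⟨ +-congʳ (*-congˡ reindex) ⟩
      y * weighted ι n + x * weighted (ι ∘ suc) n ∎
      where
      split : ∀ a u v b c → a * (u * b + v * c) ≈ u * (a * b) + v * (a * c)
      split = solve 5 (λ a u v b c → a :* (u :* b :+ v :* c) := u :* (a :* b) :+ v :* (a :* c)) refl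
      reindex : sumTo (λ j → ι (suc j) * term n (suc j)) n ≈ weighted ι n
      reindex = begin
        sumTo (λ j → ι (suc j) * term n (suc j)) n
          ≈⟨ +-identityˡ _ ⟨
        0# + sumTo (λ j → ι (suc j) * term n (suc j)) n
          ≈⟨ +-congʳ (zeroˡ _) ⟨
        ι 0 * term n 0 + sumTo (λ j → ι (suc j) * term n (suc j)) n
          ≈⟨ sumTo-sucˡ (λ m → ι m * term n m) n ⟨
        sumTo (λ m → ι m * term n m) (suc n)
          ≈⟨ sumTo-dropLast _ n (trans (*-congˡ (n<i⇒term≈0 (n<1+n n))) (zeroʳ _)) ⟩
        weighted ι n ∎

    Fubini+weighted≈weighted-suc : ∀ n → Fubini n + weighted ι n ≈ weighted (ι ∘ suc) n
    Fubini+weighted≈weighted-suc n =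
      trans (sym (sumTo-distrib-+ (term n) _ n))
            (sumTo-cong n λ m _ → sym (ι-suc-* m (term n m)))

    Fubini-recurrence : ∀ n → Fubini (suc n) + y * Fubini n ≈ (x + y) * (Fubini ⊛ Fubini) n
    Fubini-recurrence n = begin
      Fubini (suc n) + y * Fubini n
        ≈⟨ +-congʳ (Fubini-suc n) ⟩
      (y * V + x * Q) + y * Fubini n
        ≈⟨ rearrange x y V Q (Fubini n) ⟩
      x * Q + y * (Fubini n + V)
        ≈⟨ +-congˡ (*-congˡ (Fubini+weighted≈weighted-suc n)) ⟩
      x * Q + y * Q
        ≈⟨ distribʳ Q x y ⟨
      (x + y) * Q
        ≈⟨ *-congˡ (Fubini-convolution n) ⟨
      (x + y) * (Fubini ⊛ Fubini) n ∎
      where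
      V = weighted ι n
      Q = weighted (ι ∘ suc) n
      rearrange : ∀ a b v q f → (b * v + a * q) + b * f ≈ a * q + b * (f + v)
      rearrange = solve 5 (λ a b v q f → (b :* v :+ a :* q) :+ b :* f := a :* q :+ b :* (f :+ v)) refl

-- The hypotheses x, y ≠ 0 only make the paper's generating function well defined;
-- the identity itself is polynomial.
mainTheorem8 : ∀ {c ℓ} (R : CommutativeRing c ℓ) →
    let open CommutativeRing R
        open FubiniDefs R
    in (x y : Carrier) → ¬ (x ≈ 0#) → ¬ (y ≈ 0#) → (n : ℕ) →
       F (suc n) x y + y * F n x y
         ≈ (x + y) * sumTo (λ k → ι (n C k) * (F k x y * F (n ∸ k) x y)) n
mainTheorem8 R x y _ _ = FubiniIdentity.Polynomials.Fubini-recurrence R x y
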